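{- For all positive integers $q,d,k$ there exists $q'_0$ such that for every integer $q'\ge q'_0$ the following holds. Let $X$ be a subset of $\mathbb Q^d_q\cap B^d({\bf 0},2k)$. Then for any ${\bf x}\in CH(X)\cap\mathbb Q^d_q$ there exist $\lambda_1,\dots,\lambda_r\ge0$ and ${\bf x}_1,\dots,{\bf x}_r\in X$ such that $r\le d+1$, each $\lambda_j$ is $q'$-rational, $\sum_{j\in[r]}\lambda_j=1$, and ${\bf x}=\sum_{j\in[r]}\lambda_j{\bf x}_j$.
   Context: A real number $x$ is $q$-rational if $x=a/b$ for integers $a,b$ with $1\le b\le q$. $\mathbb Q^d_q$ is the set of points of $\mathbb R^d$ all of whose coordinates are $q$-rational. $B^d({\bf x},\rho)=\{{\bf z}\in\mathbb R^d:\|{\bf z}-{\bf x}\|\le\rho\}$ (Euclidean norm). $CH(X)$ is the convex hull of $X$ (the set of finite convex combinations of points of $X$).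
   Formalization: The hypothesis that ${\bf x}$ lies in $CH(X)$ admits only convex combinations of points of $X$ with rational weights. -}

module Defs where

open import Data.Nat as ℕ using (ℕ; zero; suc)
open import Data.Integer as ℤ using (ℤ)
open import Data.Rational using (ℚ; _/_; _+_; _*_; _≤_; 0ℚ; 1ℚ)
open import Data.Fin using (Fin; zero; suc)
open import Data.Product using (Σ; ∃; _×_)
open import Relation.Binary.PropositionalEquality using (_≡_)

Point : ℕ → Set
Point d = Fin d → ℚ

Σℚ : (n : ℕ) → (Fin n → ℚ) → ℚ
Σℚ zero    f = 0ℚ
Σℚ (suc n) f = f zero + Σℚ n (λ i → f (suc i))

-- x is q-rational: x = a / b with a ∈ ℤ, 1 ≤ b ≤ q  (written as x * b = a)
QRational : ℕ → ℚ → Set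
QRational q x = Σ ℤ λ a → Σ ℕ λ b → (1 ℕ.≤ b) × (b ℕ.≤ q) × (x * (ℤ.+ b / 1) ≡ a / 1)

InQd : (d q : ℕ) → Point d → Set
InQd d q z = (i : Fin d) → QRational q (z i)

-- z ∈ B^d(0, ρ) for ρ a natural number:  ‖z‖ ≤ ρ  ⇔  Σ z_i² ≤ ρ²
InBall0 : (d : ℕ) → ℕ → Point d → Set
InBall0 d ρ z = Σℚ d (λ i → z i * z i) ≤ (ℤ.+ (ρ ℕ.* ρ)) / 1

IsCombination : (d r : ℕ) → (Fin r → ℚ) → (Fin r → Point d) → Point d → Set
IsCombination d r lam xs x = (i : Fin d) → x i ≡ Σℚ r (λ j → lam j * xs j i)

IsConvexComb : (d : ℕ) → (Point d → Set) → (r : ℕ) → (Fin r → ℚ) → (Fin r → Point d) → Point d → Set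
IsConvexComb d X r lam xs x =
  ((j : Fin r) → 0ℚ ≤ lam j) × ((j : Fin r) → X (xs j)) ×
  (Σℚ r lam ≡ 1ℚ) × IsCombination d r lam xs x

InCH : (d : ℕ) → (Point d → Set) → Point d → Set
InCH d X x = Σ ℕ λ r → Σ (Fin r → ℚ) λ lam → Σ (Fin r → Point d) λ xs → IsConvexComb d X r lam xs x

-- By Carathéodory's theorem x is a convex combination of at most d + 1 affinely
-- independent points of X, and for affinely independent points the weights are unique:
-- they are the coefficients of (1, x) in the basis (1, xⱼ) of their span. All coordinates
-- involved are q-rational of absolute value at most 2k, so the points range over a
-- finite set, and the weights, being a function of the configuration of points, have
-- denominators bounded by a constant depending only on q, d and k.

module Submission where

open import Defs

module _ where
  open import Data.Nat as ℕ using (ℕ; zero; suc)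
  import Data.Nat.Properties as ℕₚ
  open import Data.Nat.Coprimality using (1-coprimeTo) renaming (sym to coprime-sym)
  open import Data.Integer as ℤ using (ℤ; _⊖_)
  import Data.Integer.Properties as ℤₚ
  open import Data.Rational
  open import Data.Rational.Properties
  import Data.Rational.Unnormalised as ℚᵘ
  open import Data.Rational.Solver using (module +-*-Solver)
  open import Data.Fin using (Fin; zero; suc; punchIn; punchOut; toℕ; fromℕ<)
  open import Data.Fin.Properties using (punchIn-punchOut; toℕ-fromℕ<)
  open import Data.Vec.Functional using (_∷_; tail; insertAt)
  open import Data.Vec.Functional.Properties using (insertAt-lookup; insertAt-punchIn)
  open import Data.Vec as Vec using (Vec; []; lookup; tabulate)
  open import Data.Vec.Properties using (lookup∘tabulate)
  open import Data.Product using (Σ; _×_; _,_; proj₁; proj₂)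
  open import Data.Sum using (_⊎_; inj₁; inj₂)
  open import Function using (_∘_)
  open import Relation.Nullary using (¬_; yes; no)
  open import Relation.Nullary.Negation using (contradiction)
  open import Relation.Unary using (Decidable)
  open import Relation.Binary.Definitions using (tri<; tri≈; tri>)
  open import Relation.Binary.PropositionalEquality
  open import Algebra.Bundles using (CommutativeRing)
  open import Algebra.Properties.Group +-0-group using (inverseʳ-unique; x∙y⁻¹≈ε⇒x≈y)
  open import Algebra.Properties.Semiring.Sum (CommutativeRing.semiring +-*-commutativeRing)
    using (sum; ∑-distrib-+; *-distribˡ-sum; *-distribʳ-sum; sum-remove)
  open +-*-Solver

  *-cancelʳ-≡ : ∀ {x y} z .{{_ : NonZero z}} → x * z ≡ y * z → x ≡ y
  *-cancelʳ-≡ {x} {y} z xz≡yz = begin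
    x                ≡⟨ sym (*-identityʳ x) ⟩
    x * 1ℚ           ≡⟨ cong (x *_) (sym (*-inverseʳ z)) ⟩
    x * (z * 1/ z)   ≡⟨ sym (*-assoc x z _) ⟩
    x * z * 1/ z     ≡⟨ cong (_* 1/ z) xz≡yz ⟩
    y * z * 1/ z     ≡⟨ *-assoc y z _ ⟩
    y * (z * 1/ z)   ≡⟨ cong (y *_) (*-inverseʳ z) ⟩
    y * 1ℚ           ≡⟨ *-identityʳ y ⟩
    y                ∎
    where open ≡-Reasoning

  ÷-*-cancel : ∀ x z .{{_ : NonZero z}} → x ÷ z * z ≡ x
  ÷-*-cancel x z = begin
    x * 1/ z * z     ≡⟨ *-assoc x _ z ⟩
    x * (1/ z * z)   ≡⟨ cong (x *_) (*-inverseˡ z) ⟩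
    x * 1ℚ           ≡⟨ *-identityʳ x ⟩
    x                ∎
    where open ≡-Reasoning

  Σℚ≡sum : ∀ n (f : Fin n → ℚ) → Σℚ n f ≡ sum f
  Σℚ≡sum zero    f = refl
  Σℚ≡sum (suc n) f = cong (f zero +_) (Σℚ≡sum n (λ i → f (suc i)))

  Σℚ-cong : ∀ n {f g : Fin n → ℚ} → (∀ i → f i ≡ g i) → Σℚ n f ≡ Σℚ n g
  Σℚ-cong zero    f≗g = refl
  Σℚ-cong (suc n) f≗g = cong₂ _+_ (f≗g zero) (Σℚ-cong n (λ i → f≗g (suc i)))

  Σℚ-zero : ∀ n {f : Fin n → ℚ} → (∀ i → f i ≡ 0ℚ) → Σℚ n f ≡ 0ℚ
  Σℚ-zero zero    f≗0 = refl
  Σℚ-zero (suc n) f≗0 = trans (cong₂ _+_ (f≗0 zero) (Σℚ-zero n (λ i → f≗0 (suc i)))) (+-identityˡ 0ℚ)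

  Σℚ-+ : ∀ n (f g : Fin n → ℚ) → Σℚ n (λ i → f i + g i) ≡ Σℚ n f + Σℚ n g
  Σℚ-+ n f g rewrite Σℚ≡sum n f | Σℚ≡sum n g | Σℚ≡sum n (λ i → f i + g i) = ∑-distrib-+ f g

  Σℚ-*ˡ : ∀ n a (f : Fin n → ℚ) → Σℚ n (λ i → a * f i) ≡ a * Σℚ n f
  Σℚ-*ˡ n a f rewrite Σℚ≡sum n f | Σℚ≡sum n (λ i → a * f i) = sym (*-distribˡ-sum a f)

  Σℚ-punchIn : ∀ n (p : Fin (suc n)) (f : Fin (suc n) → ℚ) → Σℚ (suc n) f ≡ f p + Σℚ n (λ k → f (punchIn p k))
  Σℚ-punchIn n p f rewrite Σℚ≡sum (suc n) f | Σℚ≡sum n (λ k → f (punchIn p k)) = sum-remove {i = p} f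

  Σℚ-*ʳ : ∀ n a (f : Fin n → ℚ) → Σℚ n (λ i → f i * a) ≡ Σℚ n f * a
  Σℚ-*ʳ n a f rewrite Σℚ≡sum n f | Σℚ≡sum n (λ i → f i * a) = sym (*-distribʳ-sum a f)

  Σℚ-neg : ∀ n (f : Fin n → ℚ) → Σℚ n (λ i → - f i) ≡ - Σℚ n f
  Σℚ-neg zero    f = refl
  Σℚ-neg (suc n) f = trans (cong (- f zero +_) (Σℚ-neg n (λ i → f (suc i)))) (sym (neg-distrib-+ (f zero) _))

  Σℚ-- : ∀ n (f g : Fin n → ℚ) → Σℚ n (λ i → f i - g i) ≡ Σℚ n f - Σℚ n g
  Σℚ-- n f g = trans (Σℚ-+ n f (λ i → - g i)) (cong (Σℚ n f +_) (Σℚ-neg n g))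

  -- Linear dependence

  record LinearCombination (m r : ℕ) (c : Fin r → ℚ) (v : Fin r → Point m) (w : Point m) : Set where
    constructor coordinatewise
    field coordinate : ∀ i → Σℚ r (λ k → c k * v k i) ≡ w i
  open LinearCombination

  LinearRelation : ∀ m r → (Fin r → ℚ) → (Fin r → Point m) → Set
  LinearRelation m r c v = LinearCombination m r c v (λ _ → 0ℚ)

  LinearlyIndependent : ∀ m r → (Fin r → Point m) → Set
  LinearlyIndependent m r v = ∀ c → LinearRelation m r c v → ∀ k → c k ≡ 0ℚ

  data Dependence (m r : ℕ) (v : Fin r → Point m) : Set where
    dependent   : (c : Fin r → ℚ) (j : Fin r) → c j ≢ 0ℚ → LinearRelation m r c v → Dependence m r v
    independent : r ℕ.≤ m → LinearlyIndependent m r v → Dependence m r v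

  all-zero-or-nonzero : ∀ r (f : Fin r → ℚ) → (∀ k → f k ≡ 0ℚ) ⊎ Σ (Fin r) (λ p → f p ≢ 0ℚ)
  all-zero-or-nonzero zero    f = inj₁ (λ ())
  all-zero-or-nonzero (suc r) f with f zero ≟ 0ℚ | all-zero-or-nonzero r (λ k → f (suc k))
  ... | no f₀≢0 | _              = inj₂ (zero , f₀≢0)
  ... | yes _   | inj₂ (p , fp≢0) = inj₂ (suc p , fp≢0)
  ... | yes f₀≡0 | inj₁ f≗0      = inj₁ λ { zero → f₀≡0 ; (suc k) → f≗0 k }

  -- One step of Gaussian elimination: subtract multiples of the pivot vector v p so that
  -- the other vectors u k vanish in the first coordinate.
  module Pivot {m r : ℕ} (v : Fin (suc r) → Point (suc m)) (p : Fin (suc r)) (pivot≢0 : v p zero ≢ 0ℚ) where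
    private instance
      pivot-nonZero : NonZero (v p zero)
      pivot-nonZero = ≢-nonZero pivot≢0

    α : Fin r → ℚ
    α k = v (punchIn p k) zero ÷ v p zero

    u : Fin r → Point (suc m)
    u k i = v (punchIn p k) i - α k * v p i

    u-zero : ∀ k → u k zero ≡ 0ℚ
    u-zero k = trans (cong (_-_ (v (punchIn p k) zero)) (÷-*-cancel (v (punchIn p k) zero) (v p zero)))
                     (+-inverseʳ (v (punchIn p k) zero))

    extend : (Fin r → ℚ) → Fin (suc r) → ℚ
    extend c = insertAt c p (- Σℚ r (λ k → c k * α k))

    extend-combination : ∀ c i → Σℚ (suc r) (λ k → extend c k * v k i) ≡ Σℚ r (λ k → c k * u k i)
    extend-combination c i = begin
      Σℚ (suc r) (λ k → extend c k * v k i)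
        ≡⟨ Σℚ-punchIn r p (λ k → extend c k * v k i) ⟩
      extend c p * v p i + Σℚ r (λ k → extend c (punchIn p k) * v (punchIn p k) i)
        ≡⟨ cong₂ _+_ (cong (_* v p i) (insertAt-lookup c p _))
                     (Σℚ-cong r (λ k → cong (_* v (punchIn p k) i) (insertAt-punchIn c p _ k))) ⟩
      - s * v p i + Σℚ r (λ k → c k * v (punchIn p k) i)
        ≡⟨ solve 3 (λ s a b → (:- s) :* a :+ b := b :- s :* a) refl s (v p i) _ ⟩
      Σℚ r (λ k → c k * v (punchIn p k) i) - s * v p i
        ≡⟨ cong (_-_ (Σℚ r (λ k → c k * v (punchIn p k) i))) (sym (Σℚ-*ʳ r (v p i) (λ k → c k * α k))) ⟩
      Σℚ r (λ k → c k * v (punchIn p k) i) - Σℚ r (λ k → c k * α k * v p i)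
        ≡⟨ sym (Σℚ-- r _ _) ⟩
      Σℚ r (λ k → c k * v (punchIn p k) i - c k * α k * v p i)
        ≡⟨ Σℚ-cong r (λ k → solve 4 (λ c a b x → c :* a :- c :* b :* x := c :* (a :- b :* x))
                                     refl (c k) (v (punchIn p k) i) (α k) (v p i)) ⟩
      Σℚ r (λ k → c k * u k i) ∎
      where
      open ≡-Reasoning
      s = Σℚ r (λ k → c k * α k)

    relation-extend : ∀ c → LinearRelation m r c (λ k → tail (u k)) → LinearRelation (suc m) (suc r) (extend c) v
    relation-extend c rel = coordinatewise λ
      { zero    → trans (extend-combination c zero) (Σℚ-zero r (λ k → trans (cong (c k *_) (u-zero k)) (*-zeroʳ (c k))))
      ; (suc i) → trans (extend-combination c (suc i)) (coordinate rel i) }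

    independent-extend : LinearlyIndependent m r (λ k → tail (u k)) → LinearlyIndependent (suc m) (suc r) v
    independent-extend indep c rel = c≗0
      where
      c' : Fin r → ℚ
      c' k = c (punchIn p k)
      s = Σℚ r (λ k → c' k * α k)
      -- The first coordinate of the relation determines the pivot coefficient.
      cp≡-s : c p ≡ - s
      cp≡-s = *-cancelʳ-≡ (v p zero) (begin
        c p * v p zero
          ≡⟨ solve 2 (λ x t → x := x :+ t :- t) refl _ T ⟩
        c p * v p zero + T - T
          ≡⟨ cong (_- T) (trans (sym (Σℚ-punchIn r p (λ k → c k * v k zero))) (coordinate rel zero)) ⟩
        0ℚ - T
          ≡⟨ +-identityˡ (- T) ⟩
        - T
          ≡⟨ cong -_ (Σℚ-cong r (λ k → cong (c' k *_) (sym (÷-*-cancel (v (punchIn p k) zero) (v p zero))))) ⟩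
        - Σℚ r (λ k → c' k * (α k * v p zero))
          ≡⟨ cong -_ (Σℚ-cong r (λ k → sym (*-assoc (c' k) _ _))) ⟩
        - Σℚ r (λ k → c' k * α k * v p zero)
          ≡⟨ cong -_ (Σℚ-*ʳ r _ _) ⟩
        - (s * v p zero)
          ≡⟨ neg-distribˡ-* s _ ⟩
        - s * v p zero ∎)
        where
        open ≡-Reasoning
        T = Σℚ r (λ k → c' k * v (punchIn p k) zero)
      c≗extend : ∀ k → c k ≡ extend c' k
      c≗extend k with k Data.Fin.≟ p
      ... | yes refl = trans cp≡-s (sym (insertAt-lookup c' p _))
      ... | no k≢p   = begin
        c k                           ≡⟨ cong c (sym (punchIn-punchOut (k≢p ∘ sym))) ⟩
        c' (punchOut (k≢p ∘ sym))     ≡⟨ sym (insertAt-punchIn c' p _ _) ⟩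
        extend c' (punchIn p _)       ≡⟨ cong (extend c') (punchIn-punchOut (k≢p ∘ sym)) ⟩
        extend c' k                   ∎
        where open ≡-Reasoning
      c'≗0 : ∀ k → c' k ≡ 0ℚ
      c'≗0 = indep c' (coordinatewise λ i → trans (sym (extend-combination c' (suc i)))
        (trans (Σℚ-cong (suc r) (λ k → cong (_* v k (suc i)) (sym (c≗extend k)))) (coordinate rel (suc i))))
      c≗0 : ∀ k → c k ≡ 0ℚ
      c≗0 k with k Data.Fin.≟ p
      ... | yes refl = trans cp≡-s (cong -_ (Σℚ-zero r (λ j → trans (cong (_* α j) (c'≗0 j)) (*-zeroˡ (α j)))))
      ... | no k≢p   = trans (cong c (sym (punchIn-punchOut (k≢p ∘ sym)))) (c'≗0 _)

  dependence : ∀ m r (v : Fin r → Point m) → Dependence m r v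
  dependence m       zero    v = independent ℕ.z≤n (λ c _ ())
  dependence zero    (suc r) v = dependent (λ _ → 1ℚ) zero 1≢0 (coordinatewise λ ())
  dependence (suc m) (suc r) v with all-zero-or-nonzero (suc r) (λ k → v k zero)
  ... | inj₁ first≗0 with dependence m (suc r) (λ k → tail (v k))
  ...   | dependent c j cj≢0 rel = dependent c j cj≢0 (coordinatewise λ
          { zero    → Σℚ-zero (suc r) (λ k → trans (cong (c k *_) (first≗0 k)) (*-zeroʳ (c k)))
          ; (suc i) → coordinate rel i })
  ...   | independent r≤m indep =
          independent (ℕₚ.m≤n⇒m≤1+n r≤m) (λ c rel → indep c (coordinatewise (coordinate rel ∘ suc)))
  dependence (suc m) (suc r) v | inj₂ (p , pivot≢0) with dependence m r (λ k → tail (Pivot.u v p pivot≢0 k))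
  ... | dependent c j cj≢0 rel =
        dependent (Pivot.extend v p pivot≢0 c) (punchIn p j)
                  (λ e → cj≢0 (trans (sym (insertAt-punchIn c p _ j)) e))
                  (Pivot.relation-extend v p pivot≢0 c rel)
  ... | independent r≤m indep = independent (ℕ.s≤s r≤m) (Pivot.independent-extend v p pivot≢0 indep)

  combination-unique : ∀ {m r v w} {c c' : Fin r → ℚ} → LinearlyIndependent m r v →
                       LinearCombination m r c v w → LinearCombination m r c' v w → ∀ k → c k ≡ c' k
  combination-unique {m} {r} {v} {w} {c} {c'} indep comb comb' k =
    x∙y⁻¹≈ε⇒x≈y (c k) (c' k) (indep (λ k → c k - c' k) relation k)
    where
    relation : LinearRelation m r (λ k → c k - c' k) v
    relation = coordinatewise λ i → begin
      Σℚ r (λ k → (c k - c' k) * v k i)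
        ≡⟨ Σℚ-cong r (λ k → solve 3 (λ a b x → (a :- b) :* x := a :* x :- b :* x) refl (c k) (c' k) (v k i)) ⟩
      Σℚ r (λ k → c k * v k i - c' k * v k i)
        ≡⟨ Σℚ-- r _ _ ⟩
      Σℚ r (λ k → c k * v k i) - Σℚ r (λ k → c' k * v k i)
        ≡⟨ cong₂ _-_ (coordinate comb i) (coordinate comb' i) ⟩
      w i - w i
        ≡⟨ +-inverseʳ (w i) ⟩
      0ℚ ∎
      where open ≡-Reasoning

  -- The coefficients of w in terms of v, read off a linear relation among w ∷ v;
  -- the value 0 is junk, for w outside the span of independent v.
  coefficients : ∀ m r → (Fin r → Point m) → Point m → Fin r → ℚ
  coefficients m r v w with dependence m (suc r) (w ∷ v)
  ... | independent _ _ = λ _ → 0ℚ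
  ... | dependent c _ _ _ with c zero ≟ 0ℚ
  ...   | yes _   = λ _ → 0ℚ
  ...   | no c₀≢0 = λ k → - c (suc k) * (1/ c zero) {{≢-nonZero c₀≢0}}

  coefficients-combination : ∀ {m r v w} (c : Fin r → ℚ) → LinearlyIndependent m r v → LinearCombination m r c v w →
                             LinearCombination m r (coefficients m r v w) v w
  coefficients-combination {m} {r} {v} {w} c indep comb with dependence m (suc r) (w ∷ v)
  ... | independent _ indep' = contradiction (indep' (1ℚ ∷ λ k → - c k) relation zero) 1≢0
    where
    relation : LinearRelation m (suc r) (1ℚ ∷ λ k → - c k) (w ∷ v)
    relation = coordinatewise λ i → begin
      1ℚ * w i + Σℚ r (λ k → - c k * v k i)  ≡⟨ cong₂ _+_ (*-identityˡ (w i))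
                                                  (trans (Σℚ-cong r (λ k → sym (neg-distribˡ-* (c k) (v k i)))) (Σℚ-neg r _)) ⟩
      w i - Σℚ r (λ k → c k * v k i)         ≡⟨ cong (_-_ (w i)) (coordinate comb i) ⟩
      w i - w i                              ≡⟨ +-inverseʳ (w i) ⟩
      0ℚ                                     ∎
      where open ≡-Reasoning
  ... | dependent c' j cj≢0 rel with c' zero ≟ 0ℚ
  ...   | yes c₀≡0 = contradiction (c'≗0 j) cj≢0
    where
    c'≗0 : ∀ k → c' k ≡ 0ℚ
    c'≗0 zero    = c₀≡0
    c'≗0 (suc k) = indep (c' ∘ suc) (coordinatewise λ i →
      let S = Σℚ r (λ k → c' (suc k) * v k i) in
      trans (sym (+-identityˡ S)) (trans (cong (_+ S) (sym (trans (cong (_* w i) c₀≡0) (*-zeroˡ (w i))))) (coordinate rel i))) k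
  ...   | no c₀≢0 = coordinatewise λ i → begin
      Σℚ r (λ k → - c' (suc k) * 1/ c₀ * v k i)
        ≡⟨ Σℚ-cong r (λ k → solve 3 (λ a b x → (:- a) :* b :* x := (:- b) :* (a :* x)) refl (c' (suc k)) (1/ c₀) (v k i)) ⟩
      Σℚ r (λ k → - 1/ c₀ * (c' (suc k) * v k i))
        ≡⟨ Σℚ-*ˡ r (- 1/ c₀) _ ⟩
      - 1/ c₀ * Σℚ r (λ k → c' (suc k) * v k i)
        ≡⟨ cong (- 1/ c₀ *_) (inverseʳ-unique (c₀ * w i) _ (coordinate rel i)) ⟩
      - 1/ c₀ * - (c₀ * w i)
        ≡⟨ solve 3 (λ a b x → (:- b) :* (:- (a :* x)) := x :* (a :* b)) refl c₀ (1/ c₀) (w i) ⟩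
      w i * (c₀ * 1/ c₀)
        ≡⟨ cong (w i *_) (*-inverseʳ c₀) ⟩
      w i * 1ℚ
        ≡⟨ *-identityʳ (w i) ⟩
      w i ∎
    where
    open ≡-Reasoning
    c₀ = c' zero
    instance _ = ≢-nonZero c₀≢0

  ≗-coefficients : ∀ {m r v w} {c : Fin r → ℚ} → LinearlyIndependent m r v → LinearCombination m r c v w →
                   ∀ k → c k ≡ coefficients m r v w k
  ≗-coefficients {c = c} indep comb = combination-unique indep comb (coefficients-combination c indep comb)

  combination-resp : ∀ {m r c v v' w w'} → (∀ k i → v k i ≡ v' k i) → (∀ i → w i ≡ w' i) →
                     LinearCombination m r c v w → LinearCombination m r c v' w'
  combination-resp {r = r} {c} v≗v' w≗w' comb = coordinatewise λ i →
    trans (Σℚ-cong r (λ k → cong (c k *_) (sym (v≗v' k i)))) (trans (coordinate comb i) (w≗w' i))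

  independent-resp : ∀ {m r v v'} → (∀ k i → v k i ≡ v' k i) → LinearlyIndependent m r v → LinearlyIndependent m r v'
  independent-resp v≗v' indep c rel = indep c (combination-resp (λ k i → sym (v≗v' k i)) (λ _ → refl) rel)

  -- Carathéodory's theorem

  argmin : ∀ n {P : Fin n → Set} → Decidable P → (f : ∀ k → .(P k) → ℚ) →
           (∀ k → ¬ P k) ⊎ Σ (Fin n) λ p → Σ (P p) λ Pp → ∀ k (Pk : P k) → f p Pp ≤ f k Pk
  argmin zero    P? f = inj₁ (λ ())
  argmin (suc n) P? f with argmin n (P? ∘ suc) (f ∘ suc) | P? zero
  ... | inj₁ none          | no ¬P₀ = inj₁ λ { zero → ¬P₀ ; (suc k) → none k }
  ... | inj₁ none          | yes P₀ = inj₂ (zero , P₀ , λ { zero _ → ≤-refl ; (suc k) Pk → contradiction Pk (none k) })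
  ... | inj₂ (p , Pp , min) | no ¬P₀ = inj₂ (suc p , Pp , λ { zero P₀ → contradiction P₀ ¬P₀ ; (suc k) Pk → min k Pk })
  ... | inj₂ (p , Pp , min) | yes P₀ with f zero P₀ ≤? f (suc p) Pp
  ...   | yes f₀≤ = inj₂ (zero , P₀ , λ { zero _ → ≤-refl ; (suc k) Pk → ≤-trans f₀≤ (min k Pk) })
  ...   | no f₀≰  = inj₂ (suc p , Pp , λ { zero _ → <⇒≤ (≰⇒> f₀≰) ; (suc k) Pk → min k Pk })

  combination-minus-relation : ∀ {m r v w} {c μ : Fin r → ℚ} → LinearCombination m r c v w → LinearRelation m r μ v →
                               ∀ t → LinearCombination m r (λ k → c k - t * μ k) v w
  combination-minus-relation {m} {r} {v} {w} {c} {μ} comb rel t = coordinatewise λ i → begin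
    Σℚ r (λ k → (c k - t * μ k) * v k i)
      ≡⟨ Σℚ-cong r (λ k → solve 4 (λ a t b x → (a :- t :* b) :* x := a :* x :- t :* (b :* x)) refl (c k) t (μ k) (v k i)) ⟩
    Σℚ r (λ k → c k * v k i - t * (μ k * v k i))
      ≡⟨ Σℚ-- r _ _ ⟩
    Σℚ r (λ k → c k * v k i) - Σℚ r (λ k → t * (μ k * v k i))
      ≡⟨ cong₂ _-_ (coordinate comb i) (trans (Σℚ-*ˡ r t _) (cong (t *_) (coordinate rel i))) ⟩
    w i - t * 0ℚ
      ≡⟨ solve 2 (λ w t → w :- t :* con 0ℚ := w) refl (w i) t ⟩
    w i ∎
    where open ≡-Reasoning

  combination-punchIn : ∀ {m r v w} {c : Fin (suc r) → ℚ} → LinearCombination m (suc r) c v w → ∀ p → c p ≡ 0ℚ →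
                        LinearCombination m r (c ∘ punchIn p) (v ∘ punchIn p) w
  combination-punchIn {m} {r} {v} {w} {c} comb p cp≡0 = coordinatewise λ i →
    let S = Σℚ r (λ k → c (punchIn p k) * v (punchIn p k) i) in begin
    S                              ≡⟨ sym (+-identityˡ S) ⟩
    0ℚ + S                         ≡⟨ cong (_+ S) (sym (trans (cong (_* v p i) cp≡0) (*-zeroˡ (v p i)))) ⟩
    c p * v p i + S                ≡⟨ sym (Σℚ-punchIn r p (λ k → c k * v k i)) ⟩
    Σℚ (suc r) (λ k → c k * v k i) ≡⟨ coordinate comb i ⟩
    w i                            ∎
    where open ≡-Reasoning

  p≤q⇒0≤q-p : ∀ {p q} → p ≤ q → 0ℚ ≤ q - p
  p≤q⇒0≤q-p {p} {q} p≤q = subst (_≤ q - p) (+-inverseʳ p) (+-monoˡ-≤ (- p) p≤q)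

  -- Moving along the relation μ by the least ratio c k / μ k with μ k > 0 keeps every
  -- coefficient nonnegative and makes the one at the minimising index vanish.
  eliminate-vector : ∀ {m r v w} {c μ : Fin (suc r) → ℚ} →
                     (∀ k → 0ℚ ≤ c k) → LinearCombination m (suc r) c v w →
                     LinearRelation m (suc r) μ v → ∀ j → 0ℚ < μ j →
                     Σ (Fin (suc r)) λ p → Σ (Fin r → ℚ) λ c' →
                       (∀ k → 0ℚ ≤ c' k) × LinearCombination m r c' (v ∘ punchIn p) w
  eliminate-vector {m} {r} {v} {w} {c} {μ} c≥0 comb rel j μj>0 = eliminate (argmin (suc r) (λ k → 0ℚ <? μ k) ratio)
    where
    ratio : ∀ k → .(0ℚ < μ k) → ℚ
    ratio k μk>0 = (c k ÷ μ k) {{pos⇒nonZero (μ k) {{positive μk>0}}}}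

    ratio-cancel : ∀ k (μk>0 : 0ℚ < μ k) → ratio k μk>0 * μ k ≡ c k
    ratio-cancel k μk>0 = ÷-*-cancel (c k) (μ k) {{pos⇒nonZero (μ k) {{positive μk>0}}}}

    eliminate : (∀ k → ¬ 0ℚ < μ k) ⊎
                Σ (Fin (suc r)) (λ p → Σ (0ℚ < μ p) λ μp>0 → ∀ k μk>0 → ratio p μp>0 ≤ ratio k μk>0) →
                Σ (Fin (suc r)) λ p → Σ (Fin r → ℚ) λ c' →
                  (∀ k → 0ℚ ≤ c' k) × LinearCombination m r c' (v ∘ punchIn p) w
    eliminate (inj₁ none) = contradiction μj>0 (none j)
    eliminate (inj₂ (p , μp>0 , minimal)) =
      p , c' ∘ punchIn p , c'≥0 ∘ punchIn p ,
      combination-punchIn (combination-minus-relation comb rel t) p c'p≡0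
      where
      t = ratio p μp>0
      c' : Fin (suc r) → ℚ
      c' k = c k - t * μ k
      t≥0 : 0ℚ ≤ t
      t≥0 = *-cancelʳ-≤-pos (μ p) {{positive μp>0}}
              (subst₂ _≤_ (sym (*-zeroˡ (μ p))) (sym (ratio-cancel p μp>0)) (c≥0 p))
      tμ≤c : ∀ k → t * μ k ≤ c k
      tμ≤c k with 0ℚ <? μ k
      ... | yes μk>0 = subst (t * μ k ≤_) (ratio-cancel k μk>0)
                         (*-monoʳ-≤-nonNeg (μ k) {{nonNegative (<⇒≤ μk>0)}} (minimal k μk>0))
      ... | no μk≯0  = ≤-trans (subst (t * μ k ≤_) (*-zeroʳ t) (*-monoˡ-≤-nonNeg t {{nonNegative t≥0}} (≮⇒≥ μk≯0)))
                               (c≥0 k)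
      c'≥0 : ∀ k → 0ℚ ≤ c' k
      c'≥0 k = p≤q⇒0≤q-p (tμ≤c k)
      c'p≡0 : c' p ≡ 0ℚ
      c'p≡0 = trans (cong (_-_ (c p)) (ratio-cancel p μp>0)) (+-inverseʳ (c p))

  relation-with-positive-coefficient : ∀ {m r v} {μ : Fin r → ℚ} → LinearRelation m r μ v → ∀ j → μ j ≢ 0ℚ →
                                       Σ (Fin r → ℚ) λ ν → 0ℚ < ν j × LinearRelation m r ν v
  relation-with-positive-coefficient {m} {r} {v} {μ} rel j μj≢0 with <-cmp (μ j) 0ℚ
  ... | tri> _ _ μj>0 = μ , μj>0 , rel
  ... | tri≈ _ μj≡0 _ = contradiction μj≡0 μj≢0
  ... | tri< μj<0 _ _ = (λ k → - μ k) , neg-antimono-< μj<0 , coordinatewise λ i →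
        trans (Σℚ-cong r (λ k → sym (neg-distribˡ-* (μ k) (v k i)))) (trans (Σℚ-neg r _) (cong -_ (coordinate rel i)))

  AffinelyIndependent : ∀ d r → (Fin r → Point d) → Set
  AffinelyIndependent d r xs = LinearlyIndependent (suc d) r (λ k → 1ℚ ∷ xs k)

  -- Σ λ_k = 1 and x = Σ λ_k x_k together say that (1, x) = Σ λ_k (1, x_k).
  AffineCombination : ∀ d r → (Fin r → ℚ) → (Fin r → Point d) → Point d → Set
  AffineCombination d r lam xs x = LinearCombination (suc d) r lam (λ k → 1ℚ ∷ xs k) (1ℚ ∷ x)

  affineCombination : ∀ {d r lam xs x} → Σℚ r lam ≡ 1ℚ → IsCombination d r lam xs x → AffineCombination d r lam xs x
  affineCombination {r = r} {lam} Σlam≡1 comb = coordinatewise λ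
    { zero    → trans (Σℚ-cong r (λ k → *-identityʳ (lam k))) Σlam≡1
    ; (suc i) → sym (comb i) }

  convexComb : ∀ {d X r lam xs x} → (∀ k → 0ℚ ≤ lam k) → (∀ k → X (xs k)) → AffineCombination d r lam xs x →
               IsConvexComb d X r lam xs x
  convexComb {r = r} {lam} lam≥0 xs∈X comb =
    lam≥0 , xs∈X , trans (Σℚ-cong r (λ k → sym (*-identityʳ (lam k)))) (coordinate comb zero) ,
    λ i → sym (coordinate comb (suc i))

  caratheodory : ∀ {d X x} r lam xs → IsConvexComb d X r lam xs x →
                 Σ ℕ λ r' → Σ (Fin r' → ℚ) λ lam' → Σ (Fin r' → Point d) λ xs' →
                   IsConvexComb d X r' lam' xs' x × r' ℕ.≤ suc d × AffinelyIndependent d r' xs'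
  caratheodory zero lam xs cc = zero , lam , xs , cc , ℕ.z≤n , λ c _ ()
  caratheodory {d} {X} (suc r) lam xs cc@(lam≥0 , xs∈X , Σlam≡1 , comb)
    with dependence (suc d) (suc r) (λ k → 1ℚ ∷ xs k)
  ... | independent r≤d indep = suc r , lam , xs , cc , r≤d , indep
  ... | dependent μ j μj≢0 rel with relation-with-positive-coefficient rel j μj≢0
  ...   | ν , νj>0 , rel' with eliminate-vector lam≥0 (affineCombination Σlam≡1 comb) rel' j νj>0
  ...     | p , lam' , lam'≥0 , comb' =
            caratheodory {X = X} r lam' (xs ∘ punchIn p) (convexComb {X = X} lam'≥0 (xs∈X ∘ punchIn p) comb')

  -- Bounded q-rational numbers

  fromℤ : ℤ → ℚ
  fromℤ i = i / 1

  -- i / 1 normalises through a gcd computation; the equal unnormalised form computes.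
  fromℤ≡mkℚ : ∀ i → fromℤ i ≡ mkℚ i 0 (coprime-sym (1-coprimeTo ℤ.∣ i ∣))
  fromℤ≡mkℚ i = ↥p/↧p≡p (mkℚ i 0 _)

  fromℤ-* : ∀ i j → fromℤ (i ℤ.* j) ≡ fromℤ i * fromℤ j
  fromℤ-* i j = sym (cong₂ _*_ (fromℤ≡mkℚ i) (fromℤ≡mkℚ j))

  fromℤ-mono-≤ : ∀ {i j} → i ℤ.≤ j → fromℤ i ≤ fromℤ j
  fromℤ-mono-≤ {i} {j} i≤j rewrite fromℤ≡mkℚ i | fromℤ≡mkℚ j = *≤* (ℤₚ.*-monoʳ-≤-nonNeg (ℤ.+ 1) i≤j)

  fromℤ-cancel-≤ : ∀ {i j} → fromℤ i ≤ fromℤ j → i ℤ.≤ j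
  fromℤ-cancel-≤ {i} {j} i≤j rewrite fromℤ≡mkℚ i | fromℤ≡mkℚ j with i≤j
  ... | *≤* i*1≤j*1 = subst₂ ℤ._≤_ (ℤₚ.*-identityʳ i) (ℤₚ.*-identityʳ j) i*1≤j*1

  ∣fromℤ∣ : ∀ i → ∣ fromℤ i ∣ ≡ fromℤ (ℤ.+ ℤ.∣ i ∣)
  ∣fromℤ∣ i = trans (cong ∣_∣ (fromℤ≡mkℚ i)) (sym (fromℤ≡mkℚ (ℤ.+ ℤ.∣ i ∣)))

  0≤fromℤ+ : ∀ n → 0ℚ ≤ fromℤ (ℤ.+ n)
  0≤fromℤ+ n = fromℤ-mono-≤ {ℤ.+ 0} {ℤ.+ n} (ℤ.+≤+ ℕ.z≤n)

  fromℤ-nonZero : ∀ n → NonZero (fromℤ (ℤ.+ suc n))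
  fromℤ-nonZero n = subst NonZero (sym (fromℤ≡mkℚ (ℤ.+ suc n))) _

  *-denominator : ∀ p → p * fromℤ (ℤ.+ ↧ₙ p) ≡ fromℤ (↥ p)
  *-denominator (mkℚ n d _) rewrite fromℤ≡mkℚ (ℤ.+ suc d) =
    fromℚᵘ-cong {ℚᵘ.mkℚᵘ (n ℤ.* ℤ.+ suc d) (d ℕ.* 1)} {ℚᵘ.mkℚᵘ n 0} (ℚᵘ.*≡* (begin
      n ℤ.* ℤ.+ suc d ℤ.* ℤ.+ 1     ≡⟨ ℤₚ.*-identityʳ _ ⟩
      n ℤ.* ℤ.+ suc d               ≡⟨ cong (λ e → n ℤ.* ℤ.+ suc e) (sym (ℕₚ.*-identityʳ d)) ⟩
      n ℤ.* ℤ.+ suc (d ℕ.* 1)       ∎))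
    where open ≡-Reasoning

  p*p≡∣p∣*∣p∣ : ∀ p → p * p ≡ ∣ p ∣ * ∣ p ∣
  p*p≡∣p∣*∣p∣ p with ∣p∣≡p∨∣p∣≡-p p
  ... | inj₁ ∣p∣≡p  = sym (cong₂ _*_ ∣p∣≡p ∣p∣≡p)
  ... | inj₂ ∣p∣≡-p = trans (solve 1 (λ p → p :* p := (:- p) :* (:- p)) refl p) (sym (cong₂ _*_ ∣p∣≡-p ∣p∣≡-p))

  0≤p*p : ∀ p → 0ℚ ≤ p * p
  0≤p*p p = subst (0ℚ ≤_) (sym (p*p≡∣p∣*∣p∣ p))
              (nonNegative⁻¹ _ {{nonNeg*nonNeg⇒nonNeg (∣ p ∣) {{∣-∣-nonNeg p}} (∣ p ∣) {{∣-∣-nonNeg p}}}})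

  p*p≤q*q⇒∣p∣≤q : ∀ {p q} → 0ℚ ≤ q → p * p ≤ q * q → ∣ p ∣ ≤ q
  p*p≤q*q⇒∣p∣≤q {p} {q} q≥0 pp≤qq = ≮⇒≥ λ q<∣p∣ → <-irrefl refl (begin-strict
    q * q          ≤⟨ *-monoʳ-≤-nonNeg q {{nonNegative q≥0}} (<⇒≤ q<∣p∣) ⟩
    ∣ p ∣ * q      <⟨ *-monoʳ-<-pos ∣ p ∣ {{positive (≤-<-trans q≥0 q<∣p∣)}} q<∣p∣ ⟩
    ∣ p ∣ * ∣ p ∣  ≡⟨ sym (p*p≡∣p∣*∣p∣ p) ⟩
    p * p          ≤⟨ pp≤qq ⟩
    q * q          ∎)
    where open ≤-Reasoning

  Σℚ-mono-≤ : ∀ n {f g : Fin n → ℚ} → (∀ i → f i ≤ g i) → Σℚ n f ≤ Σℚ n g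
  Σℚ-mono-≤ zero    f≤g = ≤-refl
  Σℚ-mono-≤ (suc n) f≤g = +-mono-≤ (f≤g zero) (Σℚ-mono-≤ n (f≤g ∘ suc))

  term≤Σℚ : ∀ n {f : Fin n → ℚ} → (∀ i → 0ℚ ≤ f i) → ∀ i → f i ≤ Σℚ n f
  term≤Σℚ (suc n) {f} f≥0 i = begin
    f i                                  ≡⟨ sym (+-identityʳ (f i)) ⟩
    f i + 0ℚ                             ≡⟨ cong (f i +_) (sym (Σℚ-zero n (λ _ → refl))) ⟩
    f i + Σℚ n (λ _ → 0ℚ)                ≤⟨ +-monoʳ-≤ (f i) (Σℚ-mono-≤ n (λ k → f≥0 (punchIn i k))) ⟩
    f i + Σℚ n (λ k → f (punchIn i k))   ≡⟨ sym (Σℚ-punchIn n i f) ⟩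
    Σℚ (suc n) f                         ∎
    where open ≤-Reasoning

  ∣Σℚ∣≤Σℚ∣∣ : ∀ n (f : Fin n → ℚ) → ∣ Σℚ n f ∣ ≤ Σℚ n (λ i → ∣ f i ∣)
  ∣Σℚ∣≤Σℚ∣∣ zero    f = ≤-refl
  ∣Σℚ∣≤Σℚ∣∣ (suc n) f =
    ≤-trans (∣p+q∣≤∣p∣+∣q∣ (f zero) _) (+-monoʳ-≤ ∣ f zero ∣ (∣Σℚ∣≤Σℚ∣∣ n (f ∘ suc)))

  ∣convex-combination∣≤ : ∀ r {lam y : Fin r → ℚ} {C} → (∀ j → 0ℚ ≤ lam j) → Σℚ r lam ≡ 1ℚ →
                          (∀ j → ∣ y j ∣ ≤ C) → ∣ Σℚ r (λ j → lam j * y j) ∣ ≤ C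
  ∣convex-combination∣≤ r {lam} {y} {C} lam≥0 Σlam≡1 ∣y∣≤C = begin
    ∣ Σℚ r (λ j → lam j * y j) ∣       ≤⟨ ∣Σℚ∣≤Σℚ∣∣ r _ ⟩
    Σℚ r (λ j → ∣ lam j * y j ∣)
      ≡⟨ Σℚ-cong r (λ j → trans (∣p*q∣≡∣p∣*∣q∣ (lam j) (y j)) (cong (_* ∣ y j ∣) (0≤p⇒∣p∣≡p (lam≥0 j)))) ⟩
    Σℚ r (λ j → lam j * ∣ y j ∣)
      ≤⟨ Σℚ-mono-≤ r (λ j → *-monoˡ-≤-nonNeg (lam j) {{nonNegative (lam≥0 j)}} (∣y∣≤C j)) ⟩
    Σℚ r (λ j → lam j * C)             ≡⟨ Σℚ-*ʳ r C lam ⟩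
    Σℚ r lam * C                       ≡⟨ cong (_* C) Σlam≡1 ⟩
    1ℚ * C                             ≡⟨ *-identityˡ C ⟩
    C                                  ∎
    where open ≤-Reasoning

  numerator-≤ : ∀ {z b q} a ρ → z * fromℤ (ℤ.+ b) ≡ fromℤ a → ∣ z ∣ ≤ fromℤ (ℤ.+ ρ) → b ℕ.≤ q →
                ℤ.∣ a ∣ ℕ.≤ ρ ℕ.* q
  numerator-≤ {z} {b} {q} a ρ zb≡a ∣z∣≤ρ b≤q = ℤₚ.drop‿+≤+ (fromℤ-cancel-≤ (begin
    fromℤ (ℤ.+ ℤ.∣ a ∣)           ≡⟨ sym (∣fromℤ∣ a) ⟩
    ∣ fromℤ a ∣                   ≡⟨ cong ∣_∣ (sym zb≡a) ⟩
    ∣ z * fromℤ (ℤ.+ b) ∣         ≡⟨ trans (∣p*q∣≡∣p∣*∣q∣ z _) (cong (∣ z ∣ *_) (∣fromℤ∣ (ℤ.+ b))) ⟩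
    ∣ z ∣ * fromℤ (ℤ.+ b)         ≤⟨ *-monoʳ-≤-nonNeg (fromℤ (ℤ.+ b)) {{nonNegative (0≤fromℤ+ b)}} ∣z∣≤ρ ⟩
    fromℤ (ℤ.+ ρ) * fromℤ (ℤ.+ b) ≡⟨ sym (trans (cong fromℤ (ℤₚ.pos-* ρ b)) (fromℤ-* (ℤ.+ ρ) (ℤ.+ b))) ⟩
    fromℤ (ℤ.+ (ρ ℕ.* b))         ≤⟨ fromℤ-mono-≤ (ℤ.+≤+ (ℕₚ.*-monoʳ-≤ ρ b≤q)) ⟩
    fromℤ (ℤ.+ (ρ ℕ.* q))         ∎))
    where open ≤-Reasoning

  InBall0⇒∣coordinate∣≤ : ∀ {d} ρ z → InBall0 d ρ z → ∀ i → ∣ z i ∣ ≤ fromℤ (ℤ.+ ρ)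
  InBall0⇒∣coordinate∣≤ {d} ρ z z∈B i = p*p≤q*q⇒∣p∣≤q (0≤fromℤ+ ρ) (begin
    z i * z i                     ≤⟨ term≤Σℚ d (λ j → 0≤p*p (z j)) i ⟩
    Σℚ d (λ j → z j * z j)        ≤⟨ z∈B ⟩
    fromℤ (ℤ.+ (ρ ℕ.* ρ))         ≡⟨ trans (cong fromℤ (ℤₚ.pos-* ρ ρ)) (fromℤ-* (ℤ.+ ρ) (ℤ.+ ρ)) ⟩
    fromℤ (ℤ.+ ρ) * fromℤ (ℤ.+ ρ) ∎)
    where open ≤-Reasoning

  -- Finitely many configurations

  record BoundedFunctions (A : Set) : Set where
    field
      bound   : (A → ℕ) → ℕ
      ≤-bound : ∀ F a → F a ℕ.≤ bound F
  open BoundedFunctions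

  Fin-bounded : ∀ n → BoundedFunctions (Fin n)
  Fin-bounded zero    .bound   F         = 0
  Fin-bounded zero    .≤-bound F ()
  Fin-bounded (suc n) .bound   F         = F zero ℕ.⊔ bound (Fin-bounded n) (F ∘ suc)
  Fin-bounded (suc n) .≤-bound F zero    = ℕₚ.m≤m⊔n (F zero) _
  Fin-bounded (suc n) .≤-bound F (suc i) = ℕₚ.≤-trans (≤-bound (Fin-bounded n) (F ∘ suc) i) (ℕₚ.m≤n⊔m (F zero) _)

  Σ-bounded : ∀ {A : Set} {B : A → Set} → BoundedFunctions A → (∀ a → BoundedFunctions (B a)) → BoundedFunctions (Σ A B)
  Σ-bounded A-bounded B-bounded .bound F = bound A-bounded (λ a → bound (B-bounded a) (λ b → F (a , b)))
  Σ-bounded A-bounded B-bounded .≤-bound F (a , b) =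
    ℕₚ.≤-trans (≤-bound (B-bounded a) (λ b → F (a , b)) b)
               (≤-bound A-bounded (λ a → bound (B-bounded a) (λ b → F (a , b))) a)

  -- Vectors rather than functions Fin n → A: F may tell pointwise equal functions apart,
  -- so a bound for all of them would need function extensionality.
  Vec-bounded : ∀ {A : Set} → BoundedFunctions A → ∀ n → BoundedFunctions (Vec A n)
  Vec-bounded A-bounded zero    .bound   F              = F []
  Vec-bounded A-bounded zero    .≤-bound F []           = ℕₚ.≤-refl
  Vec-bounded A-bounded (suc n) .bound   F              =
    bound A-bounded (λ a → bound (Vec-bounded A-bounded n) (λ v → F (a Vec.∷ v)))
  Vec-bounded A-bounded (suc n) .≤-bound F (a Vec.∷ v) =
    ℕₚ.≤-trans (≤-bound (Vec-bounded A-bounded n) (λ v → F (a Vec.∷ v)) v)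
               (≤-bound A-bounded (λ a → bound (Vec-bounded A-bounded n) (λ v → F (a Vec.∷ v))) a)

  quotient : ℤ → ℕ → ℚ
  quotient a b = (fromℤ a ÷ fromℤ (ℤ.+ suc b)) {{fromℤ-nonZero b}}

  quotient-unique : ∀ {z} a b → z * fromℤ (ℤ.+ suc b) ≡ fromℤ a → z ≡ quotient a b
  quotient-unique {z} a b zb≡a = *-cancelʳ-≡ (fromℤ (ℤ.+ suc b)) {{fromℤ-nonZero b}}
    (trans zb≡a (sym (÷-*-cancel (fromℤ a) (fromℤ (ℤ.+ suc b)) {{fromℤ-nonZero b}})))

  ⊖-surjective : ∀ {M} a → ℤ.∣ a ∣ ℕ.≤ M → Σ (Fin (suc M) × Fin (suc M)) λ (m , n) → toℕ m ⊖ toℕ n ≡ a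
  ⊖-surjective (ℤ.+ n)      n≤M  = (fromℕ< (ℕ.s≤s n≤M) , zero) , cong ℤ.+_ (toℕ-fromℕ< (ℕ.s≤s n≤M))
  ⊖-surjective ℤ.-[1+ n ]   n<M  = (zero , fromℕ< (ℕ.s≤s n<M)) , cong (0 ⊖_) (toℕ-fromℕ< (ℕ.s≤s n<M))

  -- (b , m , n) stands for the q-rational number (m - n) / (b + 1).
  QIndex : ℕ → ℕ → Set
  QIndex q M = Fin q × Fin (suc M) × Fin (suc M)

  qValue : ∀ {q M} → QIndex q M → ℚ
  qValue (b , m , n) = quotient (toℕ m ⊖ toℕ n) (toℕ b)

  QIndex-bounded : ∀ q M → BoundedFunctions (QIndex q M)
  QIndex-bounded q M = Σ-bounded (Fin-bounded q) λ _ → Σ-bounded (Fin-bounded (suc M)) λ _ → Fin-bounded (suc M)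

  qValue-surjective : ∀ {q z} ρ → QRational q z → ∣ z ∣ ≤ fromℤ (ℤ.+ ρ) →
                      Σ (QIndex q (ρ ℕ.* q)) λ ix → qValue ix ≡ z
  qValue-surjective ρ (a , zero  , ()       , _)
  qValue-surjective {q} {z} ρ (a , suc b , ℕ.s≤s _ , b<q , zb≡a) ∣z∣≤ρ
    with ⊖-surjective {ρ ℕ.* q} a (numerator-≤ a ρ zb≡a ∣z∣≤ρ b<q)
  ... | mn , m-n≡a =
        (fromℕ< b<q , mn) ,
        sym (trans (quotient-unique a b zb≡a) (cong₂ quotient (sym m-n≡a) (sym (toℕ-fromℕ< b<q))))

  Configuration : (q M d r : ℕ) → Set
  Configuration q M d r = Vec (Vec (QIndex q M) d) (suc r)

  decode : ∀ {q M d r} → Configuration q M d r → Fin (suc r) → Point d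
  decode cfg j i = qValue (lookup (lookup cfg j) i)

  barycentric : ∀ {d r} → (Fin (suc r) → Point d) → Fin r → ℚ
  barycentric {d} {r} P = coefficients (suc d) r (λ k → 1ℚ ∷ P (suc k)) (1ℚ ∷ P zero)

  configurationBound : (q M d r : ℕ) → ℕ
  configurationBound q M d r =
    bound (Σ-bounded (Fin-bounded r) λ _ → Vec-bounded (Vec-bounded (QIndex-bounded q M) d) (suc r))
          (λ (k , cfg) → ↧ₙ (barycentric (decode cfg) k))

  barycentric-≤-configurationBound : ∀ {q M d r} k (cfg : Configuration q M d r) →
                                     ↧ₙ (barycentric (decode cfg) k) ℕ.≤ configurationBound q M d r
  barycentric-≤-configurationBound {q} {M} {d} {r} k cfg =
    ≤-bound (Σ-bounded (Fin-bounded r) λ _ → Vec-bounded (Vec-bounded (QIndex-bounded q M) d) (suc r))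
            (λ (k , cfg) → ↧ₙ (barycentric (decode cfg) k)) (k , cfg)

  denominatorBound : (q d ρ : ℕ) → ℕ
  denominatorBound q d ρ = bound (Fin-bounded (suc (suc d))) (λ r → configurationBound q (ρ ℕ.* q) d (toℕ r))

  configurationBound-≤ : ∀ {q d ρ r} → r ℕ.≤ suc d → configurationBound q (ρ ℕ.* q) d r ℕ.≤ denominatorBound q d ρ
  configurationBound-≤ {q} {d} {ρ} {r} r≤1+d =
    subst (ℕ._≤ denominatorBound q d ρ) (cong (configurationBound q (ρ ℕ.* q) d) (toℕ-fromℕ< (ℕ.s≤s r≤1+d)))
          (≤-bound (Fin-bounded (suc (suc d))) (λ r → configurationBound q (ρ ℕ.* q) d (toℕ r)) (fromℕ< (ℕ.s≤s r≤1+d)))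

  -- Affinely independent points with bounded q-rational coordinates form one of finitely
  -- many configurations, and their barycentric coordinates are a function of the configuration.
  barycentric-denominator-≤ : ∀ {q d ρ r lam} (P : Fin (suc r) → Point d) → r ℕ.≤ suc d →
    (∀ j i → QRational q (P j i)) → (∀ j i → ∣ P j i ∣ ≤ fromℤ (ℤ.+ ρ)) →
    AffinelyIndependent d r (P ∘ suc) → AffineCombination d r lam (P ∘ suc) (P zero) →
    ∀ k → ↧ₙ (lam k) ℕ.≤ denominatorBound q d ρ
  barycentric-denominator-≤ {q} {d} {ρ} {r} {lam} P r≤1+d P-rational P-bounded indep comb k = begin
    ↧ₙ (lam k)                          ≡⟨ cong ↧ₙ_ lam≗barycentric ⟩
    ↧ₙ (barycentric (decode cfg) k)     ≤⟨ barycentric-≤-configurationBound {q} {ρ ℕ.* q} {d} {r} k cfg ⟩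
    configurationBound q (ρ ℕ.* q) d r  ≤⟨ configurationBound-≤ {q} {d} {ρ} r≤1+d ⟩
    denominatorBound q d ρ              ∎
    where
    open ℕₚ.≤-Reasoning
    index : ∀ j i → Σ (QIndex q (ρ ℕ.* q)) λ ix → qValue ix ≡ P j i
    index j i = qValue-surjective ρ (P-rational j i) (P-bounded j i)
    cfg : Configuration q (ρ ℕ.* q) d r
    cfg = tabulate λ j → tabulate λ i → proj₁ (index j i)
    decode≗P : ∀ j i → (1ℚ ∷ decode cfg j) i ≡ (1ℚ ∷ P j) i
    decode≗P j zero    = refl
    decode≗P j (suc i) =
      trans (cong (λ v → qValue (lookup v i)) (lookup∘tabulate (λ j → tabulate λ i → proj₁ (index j i)) j))
            (trans (cong qValue (lookup∘tabulate (λ i → proj₁ (index j i)) i)) (proj₂ (index j i)))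
    lam≗barycentric : lam k ≡ barycentric (decode cfg) k
    lam≗barycentric = ≗-coefficients {v = λ k → 1ℚ ∷ decode cfg (suc k)} {w = 1ℚ ∷ decode cfg zero} {c = lam}
      (independent-resp {v = λ k → 1ℚ ∷ P (suc k)} (λ k → sym ∘ decode≗P (suc k)) indep)
      (combination-resp {v = λ k → 1ℚ ∷ P (suc k)} {w = 1ℚ ∷ P zero}
                        (λ k → sym ∘ decode≗P (suc k)) (sym ∘ decode≗P zero) comb) k

  ↧≤⇒QRational : ∀ {q} p → ↧ₙ p ℕ.≤ q → QRational q p
  ↧≤⇒QRational p ↧p≤q = ↥ p , ↧ₙ p , ℕ.s≤s ℕ.z≤n , ↧p≤q , *-denominator p

  rational-caratheodory : ∀ q d ρ {q' X x} → denominatorBound q d ρ ℕ.≤ q' →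
    (∀ z → X z → InQd d q z × InBall0 d ρ z) → InCH d X x → InQd d q x →
    Σ ℕ λ r → Σ (Fin r → ℚ) λ lam → Σ (Fin r → Point d) λ xs →
      r ℕ.≤ suc d × (∀ j → QRational q' (lam j)) × IsConvexComb d X r lam xs x
  rational-caratheodory q d ρ {q'} {X} {x} bound≤q' X⊆ (r , lam , xs , cc) x∈Qd =
    finish (caratheodory {X = X} r lam xs cc)
    where
    finish : (Σ ℕ λ r' → Σ (Fin r' → ℚ) λ lam' → Σ (Fin r' → Point d) λ xs' →
                IsConvexComb d X r' lam' xs' x × r' ℕ.≤ suc d × AffinelyIndependent d r' xs') →
             Σ ℕ λ r → Σ (Fin r → ℚ) λ lam → Σ (Fin r → Point d) λ xs →
               r ℕ.≤ suc d × (∀ j → QRational q' (lam j)) × IsConvexComb d X r lam xs x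
    finish (r' , lam' , xs' , cc'@(lam'≥0 , xs'∈X , Σlam'≡1 , comb) , r'≤1+d , indep) =
      r' , lam' , xs' , r'≤1+d , lam'-rational , cc'
      where
      rational : ∀ j i → QRational q ((x ∷ xs') j i)
      rational zero    = x∈Qd
      rational (suc j) = proj₁ (X⊆ (xs' j) (xs'∈X j))
      bounded : ∀ j i → ∣ (x ∷ xs') j i ∣ ≤ fromℤ (ℤ.+ ρ)
      bounded zero    i = subst (λ y → ∣ y ∣ ≤ fromℤ (ℤ.+ ρ)) (sym (comb i))
        (∣convex-combination∣≤ r' {lam'} {λ j → xs' j i} {fromℤ (ℤ.+ ρ)} lam'≥0 Σlam'≡1 (λ j → bounded (suc j) i))
      bounded (suc j)   = InBall0⇒∣coordinate∣≤ ρ (xs' j) (proj₂ (X⊆ (xs' j) (xs'∈X j)))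
      lam'-rational : ∀ j → QRational q' (lam' j)
      lam'-rational j = ↧≤⇒QRational (lam' j) (ℕₚ.≤-trans
        (barycentric-denominator-≤ {q} {d} {ρ} {r'} {lam'} (x ∷ xs') r'≤1+d rational bounded indep
                                   (affineCombination {d} {r'} {lam'} {xs'} {x} Σlam'≡1 comb) j) bound≤q')

open import Data.Nat using (ℕ; suc; _≤_; _*_)
open import Data.Fin using (Fin)
open import Data.Rational using (ℚ)
open import Data.Product using (Σ; _×_; _,_)

proposition3p2 : (q d k : ℕ) → 1 ≤ q → 1 ≤ d → 1 ≤ k →
    Σ ℕ λ q'₀ → (q' : ℕ) → q'₀ ≤ q' →
    (X : Point d → Set) → ((z : Point d) → X z → InQd d q z × InBall0 d (2 * k) z) →
    (x : Point d) → InCH d X x → InQd d q x →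
    Σ ℕ λ r → Σ (Fin r → ℚ) λ lam → Σ (Fin r → Point d) λ xs →
    (r ≤ suc d) × ((j : Fin r) → QRational q' (lam j)) × IsConvexComb d X r lam xs x
proposition3p2 q d k _ _ _ = denominatorBound q d (2 * k) ,
  λ q' bound≤q' X X⊆ x x∈CH x∈Qd → rational-caratheodory q d (2 * k) {q'} {X} {x} bound≤q' X⊆ x∈CH x∈Qd
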